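{- For $p\in\mathbb{N}_0$ and all $n\in\mathbb{N}$, \begin{align*} \sum_{m=1}^nm^pH_{m-1}^3=&H_n(-p)H_n^3-3\Big(C^{(p)}_0(n)+\frac{B_p}{2}\Big)H_n^2+\frac{B_p}{2}H_n(2)\\ &+\Big(6C^{(p)}_{0,0}(n)+3D^{(p)}(B)-3C^{(p)}_1(n)-\frac p2B_{p-1}\Big)H_n\\ &-6C^{(p)}_{0,0,0}(n)+3C^{(p)}_{0,1}(n)+3C^{(p)}_{1,1}(n)-C^{(p)}_2(n). \end{align*}
   Context: $H_m(k)=\sum_{j=1}^mj^{ -k}$, $H_m=H_m(1)$ (empty sums $=0$), and $H_n(-p)=\sum_{m=1}^nm^p$. Bernoulli numbers: $\frac{te^t}{e^t-1}=\sum_{j\ge0}B_j\frac{t^j}{j!}$; the term $\frac p2B_{p-1}$ is $0$ when $p=0$. For $p\in\mathbb{N}_0$, $r\ge1$, $a_2,\dots,a_r\in\mathbb{N}_0$ and $a_1=0$, $$C^{(p)}_{a_2,\dots,a_r}(x)=\sum_{\substack{j_1,\dots,j_r\ge0\\ j_1+\dots+j_r\le p-a_r}}\Big(\prod_{i=1}^r\frac{\binom{p+1-a_i-j_1-\dots-j_{i-1}}{j_i}B_{j_i}}{p+1-a_i-j_1-\dots-j_{i-1}}\Big)x^{p+1-a_r-j_1-\dots-j_r}$$ (empty sum $=0$); for $r=1$ this is $C^{(p)}(x)=\sum_{j=0}^p\binom{p+1}{j}\frac{B_j}{p+1}x^{p+1-j}$. $D^{(p)}(x):=C^{(p)}(x)/x$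 (a polynomial), and $D^{(p)}(B)$ is obtained by replacing each $x^i$ in $D^{(p)}(x)$ by $B_i$. -}

module Defs where

open import Data.Nat as ℕ using (ℕ; zero; suc; _∸_; _≤?_)
open import Data.Nat.Combinatorics using (_C_)
open import Data.Integer using (+_)
open import Data.Rational using (ℚ; 0ℚ; 1ℚ; _+_; _*_; _-_; _/_)
open import Data.List using (List; []; _∷_; _++_; [_])
open import Data.Bool using (if_then_else_)
open import Relation.Nullary using (does)

⟦_⟧ : ℕ → ℚ
⟦ n ⟧ = + n / 1

-- 1/N, with the (never used) convention 1/0 = 0
inv : ℕ → ℚ
inv zero    = 0ℚ
inv (suc n) = + 1 / suc n

pow : ℚ → ℕ → ℚ
pow x zero    = 1ℚ
pow x (suc k) = x * pow x k

∑ : ℕ → (ℕ → ℚ) → ℚ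
∑ zero    f = 0ℚ
∑ (suc n) f = ∑ n f + f n

∑₁ : ℕ → (ℕ → ℚ) → ℚ
∑₁ n f = ∑ n (λ i → f (suc i))

Hk : ℕ → ℕ → ℚ
Hk m k = ∑₁ m (λ j → pow (inv j) k)

H : ℕ → ℚ
H m = Hk m 1

Hneg : ℕ → ℕ → ℚ
Hneg n p = ∑₁ n (λ m → pow ⟦ m ⟧ p)

-- Bernoulli numbers with t e^t/(e^t - 1) = ∑ B_j t^j / j!  (so B_1 = +1/2).
-- Comparing coefficients of t^{n+1} in  t e^t = (e^t - 1) ∑ B_j t^j/j!
-- gives  ∑_{k=0}^{n} binom(n+1,k) B_k = n+1, which determines B_n recursively.
-- bernList n = [B_0, ..., B_{n-1}]
lookupℚ : List ℚ → ℕ → ℚ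
lookupℚ []       _       = 0ℚ
lookupℚ (x ∷ xs) zero    = x
lookupℚ (x ∷ xs) (suc k) = lookupℚ xs k

bernList : ℕ → List ℚ
bernList zero    = []
bernList (suc n) =
  bernList n ++ [ (⟦ suc n ⟧ - ∑ n (λ k → ⟦ suc n C k ⟧ * lookupℚ (bernList n) k)) * inv (suc n) ]

B : ℕ → ℚ
B n = lookupℚ (bernList (suc n)) n

lastℕ : ℕ → List ℕ → ℕ
lastℕ a []       = a
lastℕ a (b ∷ bs) = lastℕ b bs

fac : ℕ → ℕ → ℚ
fac N j = ⟦ N C j ⟧ * B j * inv N

-- C^{(p)}_{a_2,...,a_r}(x), with a_1 = 0; the argument list is [a_2,...,a_r].
-- go J rest: J = j_1+...+j_{i-1}, rest = [a_i,...,a_r]; ar = a_r.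
-- Summation over j_i ∈ {0..p+1} restricted to  a_r + J + j_i ≤ p
-- (i.e. j_1+...+j_r ≤ p - a_r).  Inside the summation domain all the
-- truncated subtractions below are exact when a_i ≤ a_r (the only case used).
Cp : ℕ → List ℕ → ℚ → ℚ
Cp p as x = go 0 (0 ∷ as)
  where
  ar : ℕ
  ar = lastℕ 0 as
  go : ℕ → List ℕ → ℚ
  go J []         = pow x (suc p ∸ ar ∸ J)
  go J (a ∷ rest) =
    ∑ (suc (suc p)) (λ j →
      if does (ar ℕ.+ J ℕ.+ j ≤? p)
      then fac (suc p ∸ (a ℕ.+ J)) j * go (J ℕ.+ j) rest
      else 0ℚ)

-- D^{(p)}(B): D^{(p)}(x) = C^{(p)}(x)/x = ∑_{j=0}^p binom(p+1,j) B_j/(p+1) x^{p-j},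
-- with x^i replaced by B_i.
DB : ℕ → ℚ
DB p = ∑ (suc p) (λ j → fac (suc p) j * B (p ∸ j))

-- Both sides vanish at n = 0, so it suffices that the right-hand side grows by (n+1)^p H_n^3 from n to n+1.
-- Faulhaber's formula C^{(q)}(n+1) = C^{(q)}(n) + (n+1)^q, a consequence of B_k(y+1) = B_k(y) + k (y+1)^{k-1} for
-- the Bernoulli polynomials, lets every nested sum telescope one level: C^{(q)}_{a,…,a} increases from n to n+1 by
-- the same sum with one index fewer, evaluated at n+1 and divided by n+1. With no index left, one meets C^{(q)}(n+1)
-- with its lowest terms removed; their coefficients B_q and (q/2) B_{q-1}, and D^{(p)}(B) for C^{(p)}_{0,1}, are the
-- correction terms of the formula. What remains is a polynomial identity in H_n, 1/(n+1) and the values at n.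
module Submission where

open import Defs
open import Data.Nat as ℕ using (ℕ; zero; suc; _∸_; _!; z≤n; s≤s; _≤?_)
import Data.Nat.Properties as ℕ
open import Data.Nat.Combinatorics
  using (_C_; nCk≡n!/k![n-k]!; k![n∸k]!∣n!; k>n⇒nCk≡0; nCn≡1; nC1≡n; nCk≡nC[n∸k]; nCk+nC[k+1]≡[n+1]C[k+1])
open import Data.Nat.DivMod using (m/n*n≡m)
import Data.Nat.Tactic.RingSolver as ℕ-Solver
import Data.Integer as ℤ
open import Data.Integer using (+_)
import Data.Integer.Properties as ℤ
open import Data.Nat.Coprimality using (1-coprimeTo) renaming (sym to coprime-sym)
open import Data.Rational using (ℚ; mkℚ; 0ℚ; 1ℚ; _+_; _*_; _-_; _/_)
import Data.Rational.Properties as ℚ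
open import Data.Rational.Properties using (+-*-commutativeRing; _≟_; normalize-coprime; /-cong; *-inverseʳ)
open import Data.List using (List; []; _∷_; _++_; [_]; length; replicate)
open import Data.List.Properties using (length-++)
open import Data.Bool using (if_then_else_)
open import Data.Empty using (⊥-elim)
open import Level using (0ℓ)
open import Relation.Nullary using (Dec; yes; no; ¬_; does)
open import Relation.Nullary.Decidable using (dec⇒maybe)
open import Relation.Binary.PropositionalEquality
  using (_≡_; refl; sym; trans; cong; cong₂; subst; module ≡-Reasoning)
open import Tactic.RingSolver using (solve-∀)
open import Data.Rational.Solver using (module +-*-Solver)
open +-*-Solver using (solve; _:=_; _:+_; _:*_; _:-_; con)
open import Function using (id)
import Tactic.RingSolver.Core.AlmostCommutativeRing as ACR

open ≡-Reasoning

ℚ-ring : ACR.AlmostCommutativeRing 0ℓ 0ℓ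
ℚ-ring = ACR.fromCommutativeRing +-*-commutativeRing (λ x → dec⇒maybe (0ℚ ≟ x))

⟦n⟧≡mkℚ : ∀ n → ⟦ n ⟧ ≡ mkℚ (+ n) 0 (coprime-sym (1-coprimeTo n))
⟦n⟧≡mkℚ n = normalize-coprime (coprime-sym (1-coprimeTo n))

⟦⟧-+ : ∀ m n → ⟦ m ℕ.+ n ⟧ ≡ ⟦ m ⟧ + ⟦ n ⟧
⟦⟧-+ m n rewrite ⟦n⟧≡mkℚ m | ⟦n⟧≡mkℚ n =
  /-cong (cong₂ ℤ._+_ (sym (ℤ.*-identityʳ (+ m))) (sym (ℤ.*-identityʳ (+ n)))) refl

⟦⟧-* : ∀ m n → ⟦ m ℕ.* n ⟧ ≡ ⟦ m ⟧ * ⟦ n ⟧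
⟦⟧-* m n rewrite ⟦n⟧≡mkℚ m | ⟦n⟧≡mkℚ n = /-cong (ℤ.pos-* m n) refl

⟦⟧-suc : ∀ n → ⟦ suc n ⟧ ≡ ⟦ n ⟧ + 1ℚ
⟦⟧-suc n = trans (cong ⟦_⟧ (ℕ.+-comm 1 n)) (⟦⟧-+ n 1)

⟦⟧*inv : ∀ n → ⟦ suc n ⟧ * inv (suc n) ≡ 1ℚ
⟦⟧*inv n rewrite ⟦n⟧≡mkℚ (suc n) | normalize-coprime (1-coprimeTo (suc n)) =
  *-inverseʳ (mkℚ (+ suc n) 0 (coprime-sym (1-coprimeTo (suc n))))

n∸m≡1+[n∸1+m] : ∀ {m n} → m ℕ.< n → n ∸ m ≡ suc (n ∸ suc m)
n∸m≡1+[n∸1+m] {m} {suc n} (s≤s m≤n) = ℕ.+-∸-assoc 1 m≤n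

[1+p]∸[m+n]≡1+[p∸m∸n] : ∀ {p} m n → m ℕ.+ n ℕ.≤ p → suc p ∸ (m ℕ.+ n) ≡ suc (p ∸ m ∸ n)
[1+p]∸[m+n]≡1+[p∸m∸n] {p} m n m+n≤p = trans (ℕ.+-∸-assoc 1 m+n≤p) (cong suc (sym (ℕ.∸-+-assoc p m n)))

[1+p]∸m∸n≡1+[p∸m∸n] : ∀ {p} m n → m ℕ.+ n ℕ.≤ p → suc p ∸ m ∸ n ≡ suc (p ∸ m ∸ n)
[1+p]∸m∸n≡1+[p∸m∸n] {p} m n m+n≤p = trans (ℕ.∸-+-assoc (suc p) m n) ([1+p]∸[m+n]≡1+[p∸m∸n] m n m+n≤p)

m+j≤p⇒j<1+p∸m : ∀ m {j p} → m ℕ.+ j ℕ.≤ p → j ℕ.< suc p ∸ m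
m+j≤p⇒j<1+p∸m zero    j≤p         = s≤s j≤p
m+j≤p⇒j<1+p∸m (suc m) (s≤s m+j≤p) = m+j≤p⇒j<1+p∸m m m+j≤p

j<1+p∸m⇒m+j≤p : ∀ m {j p} → j ℕ.< suc p ∸ m → m ℕ.+ j ℕ.≤ p
j<1+p∸m⇒m+j≤p zero          j<1+p = ℕ.≤-pred j<1+p
j<1+p∸m⇒m+j≤p (suc m) {p = suc p} j<1+p∸m = s≤s (j<1+p∸m⇒m+j≤p m j<1+p∸m)
j<1+p∸m⇒m+j≤p (suc zero)    {p = zero} ()
j<1+p∸m⇒m+j≤p (suc (suc m)) {p = zero} ()

if-does-elim : ∀ {P : Set} (P? : Dec P) {t e : ℚ} (Q : ℚ → Set) → (P → Q t) → (¬ P → Q e) →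
  Q (if does P? then t else e)
if-does-elim (yes p) Q Qt Qe = Qt p
if-does-elim (no ¬p) Q Qt Qe = Qe ¬p

-- Finite sums

∑-cong-< : ∀ n {f g : ℕ → ℚ} → (∀ {i} → i ℕ.< n → f i ≡ g i) → ∑ n f ≡ ∑ n g
∑-cong-< zero    eq = refl
∑-cong-< (suc n) eq = cong₂ _+_ (∑-cong-< n (λ i<n → eq (ℕ.m<n⇒m<1+n i<n))) (eq ℕ.≤-refl)

∑-cong : ∀ n {f g : ℕ → ℚ} → (∀ i → f i ≡ g i) → ∑ n f ≡ ∑ n g
∑-cong n eq = ∑-cong-< n (λ {i} _ → eq i)

∑-zero : ∀ n → ∑ n (λ _ → 0ℚ) ≡ 0ℚ
∑-zero zero    = refl
∑-zero (suc n) = cong (_+ 0ℚ) (∑-zero n)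

∑-distrib-+ : ∀ n (f g : ℕ → ℚ) → ∑ n (λ i → f i + g i) ≡ ∑ n f + ∑ n g
∑-distrib-+ zero    f g = refl
∑-distrib-+ (suc n) f g = trans (cong (_+ (f n + g n)) (∑-distrib-+ n f g)) (interchange (∑ n f) (∑ n g) (f n) (g n))
  where
  interchange : ∀ a b c d → (a + b) + (c + d) ≡ (a + c) + (b + d)
  interchange = solve-∀ ℚ-ring

∑-distrib-minus : ∀ n (f g : ℕ → ℚ) → ∑ n (λ i → f i - g i) ≡ ∑ n f - ∑ n g
∑-distrib-minus zero    f g = refl
∑-distrib-minus (suc n) f g = trans (cong (_+ (f n - g n)) (∑-distrib-minus n f g)) (interchange (∑ n f) (∑ n g) (f n) (g n))
  where
  interchange : ∀ a b c d → (a - b) + (c - d) ≡ (a + c) - (b + d)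
  interchange = solve-∀ ℚ-ring

∑-*ˡ : ∀ n c (f : ℕ → ℚ) → ∑ n (λ i → c * f i) ≡ c * ∑ n f
∑-*ˡ zero    c f = sym (ℚ.*-zeroʳ c)
∑-*ˡ (suc n) c f = trans (cong (_+ c * f n) (∑-*ˡ n c f)) (sym (ℚ.*-distribˡ-+ c (∑ n f) (f n)))

∑-*ʳ : ∀ n c (f : ℕ → ℚ) → ∑ n (λ i → f i * c) ≡ ∑ n f * c
∑-*ʳ zero    c f = sym (ℚ.*-zeroˡ c)
∑-*ʳ (suc n) c f = trans (cong (_+ f n * c) (∑-*ʳ n c f)) (sym (ℚ.*-distribʳ-+ c (∑ n f) (f n)))

∑-*-zeroʳ : ∀ n (c f : ℕ → ℚ) → (∀ i → f i ≡ 0ℚ) → ∑ n (λ i → c i * f i) ≡ 0ℚ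
∑-*-zeroʳ n c f f≡0 = trans (∑-cong n (λ i → trans (cong (c i *_) (f≡0 i)) (ℚ.*-zeroʳ (c i)))) (∑-zero n)

∑-head : ∀ n (f : ℕ → ℚ) → ∑ (suc n) f ≡ f 0 + ∑ n (λ i → f (suc i))
∑-head zero    f = trans (ℚ.+-identityˡ (f 0)) (sym (ℚ.+-identityʳ (f 0)))
∑-head (suc n) f = trans (cong (_+ f (suc n)) (∑-head n f)) (ℚ.+-assoc (f 0) _ (f (suc n)))

∑-comm : ∀ m n (f : ℕ → ℕ → ℚ) → ∑ m (λ i → ∑ n (f i)) ≡ ∑ n (λ j → ∑ m (λ i → f i j))
∑-comm zero    n f = sym (∑-zero n)
∑-comm (suc m) n f =
  trans (cong (_+ ∑ n (f m)) (∑-comm m n f)) (sym (∑-distrib-+ n (λ j → ∑ m (λ i → f i j)) (f m)))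

∑-truncate : ∀ {K} M (f : ℕ → ℚ) → K ℕ.≤ M → (∀ {j} → K ℕ.≤ j → j ℕ.< M → f j ≡ 0ℚ) → ∑ M f ≡ ∑ K f
∑-truncate zero    f z≤n   vanish = refl
∑-truncate {K} (suc M) f K≤1+M vanish with K ℕ.≟ suc M
... | yes refl   = refl
... | no K≢1+M = begin
  ∑ M f + f M ≡⟨ cong₂ _+_ (∑-truncate M f K≤M (λ K≤j j<M → vanish K≤j (ℕ.m<n⇒m<1+n j<M))) (vanish K≤M ℕ.≤-refl) ⟩
  ∑ K f + 0ℚ  ≡⟨ ℚ.+-identityʳ (∑ K f) ⟩
  ∑ K f       ∎
  where K≤M = ℕ.≤-pred (ℕ.≤∧≢⇒< K≤1+M K≢1+M)

∑-reverse : ∀ k (f : ℕ → ℚ) → ∑ (suc k) f ≡ ∑ (suc k) (λ i → f (k ∸ i))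
∑-reverse zero    f = refl
∑-reverse (suc k) f = begin
  ∑ (suc k) f + f (suc k)                      ≡⟨ cong (_+ f (suc k)) (∑-reverse k f) ⟩
  ∑ (suc k) (λ i → f (k ∸ i)) + f (suc k)      ≡⟨ ℚ.+-comm _ (f (suc k)) ⟩
  f (suc k) + ∑ (suc k) (λ i → f (k ∸ i))      ≡⟨ ∑-head (suc k) (λ i → f (suc k ∸ i)) ⟨
  ∑ (suc (suc k)) (λ i → f (suc k ∸ i))        ∎

-- Binomial coefficients

C-factorial : ∀ {n k} → k ℕ.≤ n → (n C k) ℕ.* (k ! ℕ.* (n ∸ k) !) ≡ n !
C-factorial {n} {k} k≤n =
  trans (cong (ℕ._* (k ! ℕ.* (n ∸ k) !)) (nCk≡n!/k![n-k]! k≤n)) (m/n*n≡m (k![n∸k]!∣n! k≤n))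
  where instance _ = ℕ._!*_!≢0 k (n ∸ k)

[1+n]Cn≡1+n : ∀ n → suc n C n ≡ suc n
[1+n]Cn≡1+n n = begin
  suc n C n           ≡⟨ nCk≡nC[n∸k] (ℕ.n≤1+n n) ⟩
  suc n C (suc n ∸ n) ≡⟨ cong (suc n C_) (ℕ.m+n∸n≡m 1 n) ⟩
  suc n C 1           ≡⟨ nC1≡n (suc n) ⟩
  suc n               ∎

[1+m]Ci*[1+m∸i]≡[1+m]*mCi : ∀ {m i} → i ℕ.≤ m → (suc m C i) ℕ.* (suc m ∸ i) ≡ suc m ℕ.* (m C i)
[1+m]Ci*[1+m∸i]≡[1+m]*mCi {m} {i} i≤m = ℕ.*-cancelʳ-≡ _ _ (i ! ℕ.* (m ∸ i) !) (begin
  (suc m C i) ℕ.* (suc m ∸ i) ℕ.* (i ! ℕ.* (m ∸ i) !)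
    ≡⟨ cong (λ e → (suc m C i) ℕ.* e ℕ.* (i ! ℕ.* (m ∸ i) !)) 1+m∸i≡1+[m∸i] ⟩
  (suc m C i) ℕ.* suc (m ∸ i) ℕ.* (i ! ℕ.* (m ∸ i) !)
    ≡⟨ rearrange (suc m C i) (m ∸ i) (i !) ((m ∸ i) !) ⟩
  (suc m C i) ℕ.* (i ! ℕ.* suc (m ∸ i) !)
    ≡⟨ cong (λ e → (suc m C i) ℕ.* (i ! ℕ.* e !)) (sym 1+m∸i≡1+[m∸i]) ⟩
  (suc m C i) ℕ.* (i ! ℕ.* (suc m ∸ i) !)
    ≡⟨ C-factorial (ℕ.m≤n⇒m≤1+n i≤m) ⟩
  suc m ℕ.* m !
    ≡⟨ cong (suc m ℕ.*_) (C-factorial i≤m) ⟨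
  suc m ℕ.* ((m C i) ℕ.* (i ! ℕ.* (m ∸ i) !))
    ≡⟨ ℕ.*-assoc (suc m) (m C i) _ ⟨
  suc m ℕ.* (m C i) ℕ.* (i ! ℕ.* (m ∸ i) !) ∎)
  where
  instance _ = ℕ._!*_!≢0 i (m ∸ i)
  1+m∸i≡1+[m∸i] : suc m ∸ i ≡ suc (m ∸ i)
  1+m∸i≡1+[m∸i] = ℕ.+-∸-assoc 1 i≤m
  rearrange : ∀ a d b c → a ℕ.* suc d ℕ.* (b ℕ.* c) ≡ a ℕ.* (b ℕ.* (suc d ℕ.* c))
  rearrange = ℕ-Solver.solve-∀

nCi*[n∸i]Cj≡0 : ∀ n i j → n ℕ.< i ℕ.+ j → (n C i) ℕ.* ((n ∸ i) C j) ≡ 0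
nCi*[n∸i]Cj≡0 n i j n<i+j with i ℕ.≤? n
... | no  i≰n = cong (ℕ._* ((n ∸ i) C j)) (k>n⇒nCk≡0 (ℕ.≰⇒> i≰n))
... | yes i≤n = trans (cong ((n C i) ℕ.*_) (k>n⇒nCk≡0 n∸i<j)) (ℕ.*-zeroʳ (n C i))
  where
  n∸i<j : n ∸ i ℕ.< j
  n∸i<j = ℕ.+-cancelˡ-< i (n ∸ i) j (subst (ℕ._< i ℕ.+ j) (sym (ℕ.m+[n∸m]≡n i≤n)) n<i+j)

nCi*[n∸i]Cj*factorials≡n! : ∀ n i j → i ℕ.+ j ℕ.≤ n →
  (n C i) ℕ.* ((n ∸ i) C j) ℕ.* (i ! ℕ.* (j ! ℕ.* (n ∸ i ∸ j) !)) ≡ n !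
nCi*[n∸i]Cj*factorials≡n! n i j i+j≤n = begin
  (n C i) ℕ.* ((n ∸ i) C j) ℕ.* (i ! ℕ.* (j ! ℕ.* (n ∸ i ∸ j) !))
    ≡⟨ rearrange (n C i) ((n ∸ i) C j) (i !) (j ! ℕ.* (n ∸ i ∸ j) !) ⟩
  (n C i) ℕ.* (i ! ℕ.* (((n ∸ i) C j) ℕ.* (j ! ℕ.* (n ∸ i ∸ j) !)))
    ≡⟨ cong (λ e → (n C i) ℕ.* (i ! ℕ.* e)) (C-factorial j≤n∸i) ⟩
  (n C i) ℕ.* (i ! ℕ.* (n ∸ i) !)
    ≡⟨ C-factorial (ℕ.m+n≤o⇒m≤o i i+j≤n) ⟩
  n ! ∎
  where
  j≤n∸i : j ℕ.≤ n ∸ i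
  j≤n∸i = ℕ.m+n≤o⇒m≤o∸n j (subst (ℕ._≤ n) (ℕ.+-comm i j) i+j≤n)
  rearrange : ∀ a b c d → a ℕ.* b ℕ.* (c ℕ.* d) ≡ a ℕ.* (c ℕ.* (b ℕ.* d))
  rearrange = ℕ-Solver.solve-∀

nCi*[n∸i]Cj≡nCj*[n∸j]Ci : ∀ n i j → (n C i) ℕ.* ((n ∸ i) C j) ≡ (n C j) ℕ.* ((n ∸ j) C i)
nCi*[n∸i]Cj≡nCj*[n∸j]Ci n i j with i ℕ.+ j ℕ.≤? n
... | no  i+j≰n = trans (nCi*[n∸i]Cj≡0 n i j n<i+j) (sym (nCi*[n∸i]Cj≡0 n j i (subst (n ℕ.<_) (ℕ.+-comm i j) n<i+j)))
  where n<i+j = ℕ.≰⇒> i+j≰n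
... | yes i+j≤n = ℕ.*-cancelʳ-≡ _ _ (i ! ℕ.* (j ! ℕ.* (n ∸ i ∸ j) !)) (begin
  (n C i) ℕ.* ((n ∸ i) C j) ℕ.* (i ! ℕ.* (j ! ℕ.* (n ∸ i ∸ j) !))
    ≡⟨ nCi*[n∸i]Cj*factorials≡n! n i j i+j≤n ⟩
  n !
    ≡⟨ nCi*[n∸i]Cj*factorials≡n! n j i (subst (ℕ._≤ n) (ℕ.+-comm i j) i+j≤n) ⟨
  (n C j) ℕ.* ((n ∸ j) C i) ℕ.* (j ! ℕ.* (i ! ℕ.* (n ∸ j ∸ i) !))
    ≡⟨ cong ((n C j) ℕ.* ((n ∸ j) C i) ℕ.*_) factorials-comm ⟩
  (n C j) ℕ.* ((n ∸ j) C i) ℕ.* (i ! ℕ.* (j ! ℕ.* (n ∸ i ∸ j) !)) ∎)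
  where
  instance _ = ℕ.m*n≢0 (i !) (j ! ℕ.* (n ∸ i ∸ j) !) {{ℕ._!≢0 i}} {{ℕ._!*_!≢0 j (n ∸ i ∸ j)}}
  n∸j∸i≡n∸i∸j : n ∸ j ∸ i ≡ n ∸ i ∸ j
  n∸j∸i≡n∸i∸j = trans (ℕ.∸-+-assoc n j i) (trans (cong (n ∸_) (ℕ.+-comm j i)) (sym (ℕ.∸-+-assoc n i j)))
  swap : ∀ a b c → a ℕ.* (b ℕ.* c) ≡ b ℕ.* (a ℕ.* c)
  swap = ℕ-Solver.solve-∀
  factorials-comm : j ! ℕ.* (i ! ℕ.* (n ∸ j ∸ i) !) ≡ i ! ℕ.* (j ! ℕ.* (n ∸ i ∸ j) !)
  factorials-comm = trans (cong (λ e → j ! ℕ.* (i ! ℕ.* e !)) n∸j∸i≡n∸i∸j) (swap (j !) (i !) ((n ∸ i ∸ j) !))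

binomial-theorem : ∀ m y → pow (y + 1ℚ) m ≡ ∑ (suc m) (λ i → ⟦ m C i ⟧ * pow y i)
binomial-theorem zero    y = refl
binomial-theorem (suc m) y = sym (begin
  ∑ (suc (suc m)) (λ i → ⟦ suc m C i ⟧ * pow y i)
    ≡⟨ ∑-head (suc m) _ ⟩
  1ℚ + ∑ (suc m) (λ i → ⟦ suc m C suc i ⟧ * pow y (suc i))
    ≡⟨ cong (_+_ 1ℚ) (trans (∑-cong (suc m) pascal) (∑-distrib-+ (suc m) (λ i → y * b i) (λ i → b (suc i)))) ⟩
  1ℚ + (∑ (suc m) (λ i → y * b i) + (A + b (suc m)))
    ≡⟨ cong₂ (λ s t → 1ℚ + (s + (A + t))) (trans (∑-*ˡ (suc m) y b) (cong (y *_) (∑-head m b))) top-vanishes ⟩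
  1ℚ + (y * (1ℚ + A) + (A + 0ℚ))
    ≡⟨ factor y A ⟩
  (y + 1ℚ) * (1ℚ + A)
    ≡⟨ cong ((y + 1ℚ) *_) (trans (binomial-theorem m y) (∑-head m b)) ⟨
  (y + 1ℚ) * pow (y + 1ℚ) m ∎)
  where
  b : ℕ → ℚ
  b i = ⟦ m C i ⟧ * pow y i
  A = ∑ m (λ i → b (suc i))
  pascal : ∀ i → ⟦ suc m C suc i ⟧ * pow y (suc i) ≡ y * b i + b (suc i)
  pascal i = begin
    ⟦ suc m C suc i ⟧ * (y * pow y i)
      ≡⟨ cong (λ c → ⟦ c ⟧ * (y * pow y i)) (nCk+nC[k+1]≡[n+1]C[k+1] m i) ⟨
    ⟦ (m C i) ℕ.+ (m C suc i) ⟧ * (y * pow y i)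
      ≡⟨ cong (_* (y * pow y i)) (⟦⟧-+ (m C i) (m C suc i)) ⟩
    (⟦ m C i ⟧ + ⟦ m C suc i ⟧) * (y * pow y i)
      ≡⟨ distribute ⟦ m C i ⟧ ⟦ m C suc i ⟧ y (pow y i) ⟩
    y * (⟦ m C i ⟧ * pow y i) + ⟦ m C suc i ⟧ * (y * pow y i) ∎
    where
    distribute : ∀ c c′ y z → (c + c′) * (y * z) ≡ y * (c * z) + c′ * (y * z)
    distribute = solve-∀ ℚ-ring
  top-vanishes : b (suc m) ≡ 0ℚ
  top-vanishes = trans (cong (λ c → ⟦ c ⟧ * pow y (suc m)) (k>n⇒nCk≡0 (ℕ.n<1+n m))) (ℚ.*-zeroˡ (pow y (suc m)))
  factor : ∀ y A → 1ℚ + (y * (1ℚ + A) + (A + 0ℚ)) ≡ (y + 1ℚ) * (1ℚ + A)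
  factor = solve-∀ ℚ-ring

∑C-truncate : ∀ {m k} → m ℕ.≤ k → (g : ℕ → ℚ) →
  ∑ (suc k) (λ i → ⟦ m C i ⟧ * g i) ≡ ∑ (suc m) (λ i → ⟦ m C i ⟧ * g i)
∑C-truncate m≤k g = ∑-truncate _ _ (s≤s m≤k)
  (λ {i} m<i _ → trans (cong (λ c → ⟦ c ⟧ * g i) (k>n⇒nCk≡0 m<i)) (ℚ.*-zeroˡ (g i)))

∑C*pow*[k∸i]≡k*pow : ∀ k y → ∑ (suc k) (λ i → ⟦ k C i ⟧ * pow y i * ⟦ k ∸ i ⟧) ≡ ⟦ k ⟧ * pow (y + 1ℚ) (k ∸ 1)
∑C*pow*[k∸i]≡k*pow zero    y = refl
∑C*pow*[k∸i]≡k*pow (suc m) y = begin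
  ∑ (suc m) f + ⟦ suc m C suc m ⟧ * pow y (suc m) * ⟦ suc m ∸ suc m ⟧
    ≡⟨ cong (λ e → ∑ (suc m) f + ⟦ suc m C suc m ⟧ * pow y (suc m) * ⟦ e ⟧) (ℕ.n∸n≡0 m) ⟩
  ∑ (suc m) f + ⟦ suc m C suc m ⟧ * pow y (suc m) * 0ℚ
    ≡⟨ cong (_+_ (∑ (suc m) f)) (ℚ.*-zeroʳ (⟦ suc m C suc m ⟧ * pow y (suc m))) ⟩
  ∑ (suc m) f + 0ℚ
    ≡⟨ ℚ.+-identityʳ _ ⟩
  ∑ (suc m) f
    ≡⟨ ∑-cong-< (suc m) (λ i<1+m → absorb (ℕ.≤-pred i<1+m)) ⟩
  ∑ (suc m) (λ i → ⟦ suc m ⟧ * (⟦ m C i ⟧ * pow y i))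
    ≡⟨ ∑-*ˡ (suc m) ⟦ suc m ⟧ _ ⟩
  ⟦ suc m ⟧ * ∑ (suc m) (λ i → ⟦ m C i ⟧ * pow y i)
    ≡⟨ cong (⟦ suc m ⟧ *_) (binomial-theorem m y) ⟨
  ⟦ suc m ⟧ * pow (y + 1ℚ) m ∎
  where
  f : ℕ → ℚ
  f i = ⟦ suc m C i ⟧ * pow y i * ⟦ suc m ∸ i ⟧
  rearrange : ∀ c z d → c * z * d ≡ c * d * z
  rearrange = solve-∀ ℚ-ring
  absorb : ∀ {i} → i ℕ.≤ m → f i ≡ ⟦ suc m ⟧ * (⟦ m C i ⟧ * pow y i)
  absorb {i} i≤m = begin
    ⟦ suc m C i ⟧ * pow y i * ⟦ suc m ∸ i ⟧   ≡⟨ rearrange ⟦ suc m C i ⟧ (pow y i) ⟦ suc m ∸ i ⟧ ⟩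
    ⟦ suc m C i ⟧ * ⟦ suc m ∸ i ⟧ * pow y i   ≡⟨ cong (_* pow y i) (⟦⟧-* (suc m C i) (suc m ∸ i)) ⟨
    ⟦ (suc m C i) ℕ.* (suc m ∸ i) ⟧ * pow y i ≡⟨ cong (λ c → ⟦ c ⟧ * pow y i) ([1+m]Ci*[1+m∸i]≡[1+m]*mCi i≤m) ⟩
    ⟦ suc m ℕ.* (m C i) ⟧ * pow y i           ≡⟨ cong (_* pow y i) (⟦⟧-* (suc m) (m C i)) ⟩
    ⟦ suc m ⟧ * ⟦ m C i ⟧ * pow y i           ≡⟨ ℚ.*-assoc ⟦ suc m ⟧ ⟦ m C i ⟧ (pow y i) ⟩
    ⟦ suc m ⟧ * (⟦ m C i ⟧ * pow y i)         ∎

-- Bernoulli numbers and polynomials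

length-bernList : ∀ n → length (bernList n) ≡ n
length-bernList zero    = refl
length-bernList (suc n) =
  trans (length-++ (bernList n)) (trans (cong (ℕ._+ 1) (length-bernList n)) (ℕ.+-comm n 1))

lookupℚ-++ˡ : ∀ xs ys {k} → k ℕ.< length xs → lookupℚ (xs ++ ys) k ≡ lookupℚ xs k
lookupℚ-++ˡ (x ∷ xs) ys {zero}  _         = refl
lookupℚ-++ˡ (x ∷ xs) ys {suc k} (s≤s k<n) = lookupℚ-++ˡ xs ys k<n

lookupℚ-last : ∀ xs y → lookupℚ (xs ++ [ y ]) (length xs) ≡ y
lookupℚ-last []       y = refl
lookupℚ-last (x ∷ xs) y = lookupℚ-last xs y

lookupℚ-bernList : ∀ {n k} → k ℕ.< n → lookupℚ (bernList n) k ≡ B k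
lookupℚ-bernList {suc n} {k} k<1+n with k ℕ.≟ n
... | yes refl = refl
... | no  k≢n  = trans (lookupℚ-++ˡ (bernList n) _ (subst (k ℕ.<_) (sym (length-bernList n)) k<n))
                       (lookupℚ-bernList k<n)
  where k<n = ℕ.≤∧≢⇒< (ℕ.≤-pred k<1+n) k≢n

B-recurrence : ∀ n → B n ≡ (⟦ suc n ⟧ - ∑ n (λ k → ⟦ suc n C k ⟧ * B k)) * inv (suc n)
B-recurrence n = begin
  lookupℚ (bernList n ++ [ Bₙ ]) n                    ≡⟨ cong (lookupℚ (bernList n ++ [ Bₙ ])) (length-bernList n) ⟨
  lookupℚ (bernList n ++ [ Bₙ ]) (length (bernList n)) ≡⟨ lookupℚ-last (bernList n) Bₙ ⟩
  Bₙ                                                   ≡⟨ cong (λ s → (⟦ suc n ⟧ - s) * inv (suc n)) earlier-B ⟩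
  (⟦ suc n ⟧ - ∑ n (λ k → ⟦ suc n C k ⟧ * B k)) * inv (suc n) ∎
  where
  Bₙ = (⟦ suc n ⟧ - ∑ n (λ k → ⟦ suc n C k ⟧ * lookupℚ (bernList n) k)) * inv (suc n)
  earlier-B : ∑ n (λ k → ⟦ suc n C k ⟧ * lookupℚ (bernList n) k) ≡ ∑ n (λ k → ⟦ suc n C k ⟧ * B k)
  earlier-B = ∑-cong-< n (λ {k} k<n → cong (⟦ suc n C k ⟧ *_) (lookupℚ-bernList k<n))

∑[1+n]CB≡1+n : ∀ n → ∑ (suc n) (λ k → ⟦ suc n C k ⟧ * B k) ≡ ⟦ suc n ⟧
∑[1+n]CB≡1+n n = begin
  S + ⟦ suc n C n ⟧ * B n         ≡⟨ cong₂ (λ c b → S + ⟦ c ⟧ * b) ([1+n]Cn≡1+n n) (B-recurrence n) ⟩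
  S + X * ((X - S) * inv (suc n)) ≡⟨ solve-for-X S X (inv (suc n)) (⟦⟧*inv n) ⟩
  X                               ∎
  where
  S = ∑ n (λ k → ⟦ suc n C k ⟧ * B k)
  X = ⟦ suc n ⟧
  solve-for-X : ∀ S X u → X * u ≡ 1ℚ → S + X * ((X - S) * u) ≡ X
  solve-for-X S X u Xu≡1 = begin
    S + X * ((X - S) * u) ≡⟨ regroup S X u ⟩
    S + (X - S) * (X * u) ≡⟨ cong (λ v → S + (X - S) * v) Xu≡1 ⟩
    S + (X - S) * 1ℚ      ≡⟨ cancel S X ⟩
    X                     ∎
    where
    regroup : ∀ S X u → S + X * ((X - S) * u) ≡ S + (X - S) * (X * u)
    regroup = solve-∀ ℚ-ring
    cancel : ∀ S X → S + (X - S) * 1ℚ ≡ X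
    cancel = solve-∀ ℚ-ring

∑[n]CB≡B+n : ∀ n → ∑ (suc n) (λ k → ⟦ n C k ⟧ * B k) ≡ B n + ⟦ n ⟧
∑[n]CB≡B+n zero    = ℚ.+-identityˡ (1ℚ * B 0)
∑[n]CB≡B+n (suc n) = begin
  ∑ (suc n) (λ k → ⟦ suc n C k ⟧ * B k) + ⟦ suc n C suc n ⟧ * B (suc n)
    ≡⟨ cong₂ (λ s c → s + ⟦ c ⟧ * B (suc n)) (∑[1+n]CB≡1+n n) (nCn≡1 (suc n)) ⟩
  ⟦ suc n ⟧ + 1ℚ * B (suc n)
    ≡⟨ cong (_+_ ⟦ suc n ⟧) (ℚ.*-identityˡ (B (suc n))) ⟩
  ⟦ suc n ⟧ + B (suc n)
    ≡⟨ ℚ.+-comm ⟦ suc n ⟧ (B (suc n)) ⟩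
  B (suc n) + ⟦ suc n ⟧ ∎

bernoulliPoly : ℕ → ℚ → ℚ
bernoulliPoly k y = ∑ (suc k) (λ j → ⟦ k C j ⟧ * B j * pow y (k ∸ j))

bernoulliPoly-reflect : ∀ k y → ∑ (suc k) (λ i → ⟦ k C i ⟧ * pow y i * B (k ∸ i)) ≡ bernoulliPoly k y
bernoulliPoly-reflect k y = sym (trans (∑-reverse k _) (∑-cong-< (suc k) (λ i<1+k → reflect (ℕ.≤-pred i<1+k))))
  where
  swap : ∀ c b z → c * b * z ≡ c * z * b
  swap = solve-∀ ℚ-ring
  reflect : ∀ {i} → i ℕ.≤ k → ⟦ k C (k ∸ i) ⟧ * B (k ∸ i) * pow y (k ∸ (k ∸ i)) ≡ ⟦ k C i ⟧ * pow y i * B (k ∸ i)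
  reflect {i} i≤k = trans (cong₂ (λ c e → ⟦ c ⟧ * B (k ∸ i) * pow y e) (sym (nCk≡nC[n∸k] i≤k)) (ℕ.m∸[m∸n]≡n i≤k))
                          (swap ⟦ k C i ⟧ (B (k ∸ i)) (pow y i))

bernoulliPoly-+1-term : ∀ k y i →
  ∑ (suc k) (λ j → ⟦ k C j ⟧ * B j * (⟦ (k ∸ j) C i ⟧ * pow y i)) ≡ ⟦ k C i ⟧ * pow y i * (B (k ∸ i) + ⟦ k ∸ i ⟧)
bernoulliPoly-+1-term k y i = begin
  ∑ (suc k) (λ j → ⟦ k C j ⟧ * B j * (⟦ (k ∸ j) C i ⟧ * pow y i))
    ≡⟨ ∑-cong (suc k) subsets-swap ⟩
  ∑ (suc k) (λ j → ⟦ k C i ⟧ * pow y i * (⟦ (k ∸ i) C j ⟧ * B j))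
    ≡⟨ ∑-*ˡ (suc k) (⟦ k C i ⟧ * pow y i) _ ⟩
  ⟦ k C i ⟧ * pow y i * ∑ (suc k) (λ j → ⟦ (k ∸ i) C j ⟧ * B j)
    ≡⟨ cong (⟦ k C i ⟧ * pow y i *_) (trans (∑C-truncate (ℕ.m∸n≤m k i) B) (∑[n]CB≡B+n (k ∸ i))) ⟩
  ⟦ k C i ⟧ * pow y i * (B (k ∸ i) + ⟦ k ∸ i ⟧) ∎
  where
  regroup : ∀ a b c d → a * b * (c * d) ≡ (a * c) * (b * d)
  regroup = solve-∀ ℚ-ring
  regroup′ : ∀ a c b d → (a * c) * (b * d) ≡ a * d * (c * b)
  regroup′ = solve-∀ ℚ-ring
  subsets-swap : ∀ j → ⟦ k C j ⟧ * B j * (⟦ (k ∸ j) C i ⟧ * pow y i) ≡ ⟦ k C i ⟧ * pow y i * (⟦ (k ∸ i) C j ⟧ * B j)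
  subsets-swap j = begin
    ⟦ k C j ⟧ * B j * (⟦ (k ∸ j) C i ⟧ * pow y i)
      ≡⟨ regroup ⟦ k C j ⟧ (B j) ⟦ (k ∸ j) C i ⟧ (pow y i) ⟩
    (⟦ k C j ⟧ * ⟦ (k ∸ j) C i ⟧) * (B j * pow y i)
      ≡⟨ cong (_* (B j * pow y i)) (trans (sym (⟦⟧-* (k C j) ((k ∸ j) C i))) (cong ⟦_⟧ (sym (nCi*[n∸i]Cj≡nCj*[n∸j]Ci k i j)))) ⟩
    ⟦ (k C i) ℕ.* ((k ∸ i) C j) ⟧ * (B j * pow y i)
      ≡⟨ cong (_* (B j * pow y i)) (⟦⟧-* (k C i) ((k ∸ i) C j)) ⟩
    (⟦ k C i ⟧ * ⟦ (k ∸ i) C j ⟧) * (B j * pow y i)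
      ≡⟨ regroup′ ⟦ k C i ⟧ ⟦ (k ∸ i) C j ⟧ (B j) (pow y i) ⟩
    ⟦ k C i ⟧ * pow y i * (⟦ (k ∸ i) C j ⟧ * B j) ∎

bernoulliPoly-+1 : ∀ k y → bernoulliPoly k (y + 1ℚ) ≡ bernoulliPoly k y + ⟦ k ⟧ * pow (y + 1ℚ) (k ∸ 1)
bernoulliPoly-+1 k y = begin
  bernoulliPoly k (y + 1ℚ)
    ≡⟨ ∑-cong (suc k) expand ⟩
  ∑ (suc k) (λ j → ∑ (suc k) (t j))
    ≡⟨ ∑-comm (suc k) (suc k) t ⟩
  ∑ (suc k) (λ i → ∑ (suc k) (λ j → t j i))
    ≡⟨ ∑-cong (suc k) (λ i → trans (bernoulliPoly-+1-term k y i) (ℚ.*-distribˡ-+ (⟦ k C i ⟧ * pow y i) _ _)) ⟩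
  ∑ (suc k) (λ i → ⟦ k C i ⟧ * pow y i * B (k ∸ i) + ⟦ k C i ⟧ * pow y i * ⟦ k ∸ i ⟧)
    ≡⟨ ∑-distrib-+ (suc k) _ _ ⟩
  ∑ (suc k) (λ i → ⟦ k C i ⟧ * pow y i * B (k ∸ i)) + ∑ (suc k) (λ i → ⟦ k C i ⟧ * pow y i * ⟦ k ∸ i ⟧)
    ≡⟨ cong₂ _+_ (bernoulliPoly-reflect k y) (∑C*pow*[k∸i]≡k*pow k y) ⟩
  bernoulliPoly k y + ⟦ k ⟧ * pow (y + 1ℚ) (k ∸ 1) ∎
  where
  t : ℕ → ℕ → ℚ
  t j i = ⟦ k C j ⟧ * B j * (⟦ (k ∸ j) C i ⟧ * pow y i)
  expand : ∀ j → ⟦ k C j ⟧ * B j * pow (y + 1ℚ) (k ∸ j) ≡ ∑ (suc k) (t j)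
  expand j = begin
    ⟦ k C j ⟧ * B j * pow (y + 1ℚ) (k ∸ j)
      ≡⟨ cong (⟦ k C j ⟧ * B j *_) (binomial-theorem (k ∸ j) y) ⟩
    ⟦ k C j ⟧ * B j * ∑ (suc (k ∸ j)) (λ i → ⟦ (k ∸ j) C i ⟧ * pow y i)
      ≡⟨ cong (⟦ k C j ⟧ * B j *_) (∑C-truncate (ℕ.m∸n≤m k j) (pow y)) ⟨
    ⟦ k C j ⟧ * B j * ∑ (suc k) (λ i → ⟦ (k ∸ j) C i ⟧ * pow y i)
      ≡⟨ ∑-*ˡ (suc k) (⟦ k C j ⟧ * B j) _ ⟨
    ∑ (suc k) (t j) ∎

-- The polynomials C^{(q)}_{a,…,a}

-- C⁰ (suc r) q is the paper's C^{(q)}_{0,…,0} with r zero indices; in particular C⁰ 1 q = C^{(q)}.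
C⁰ : ℕ → ℕ → ℚ → ℚ
C⁰ zero    q x = pow x (suc q)
C⁰ (suc r) q x = ∑ (suc q) (λ j → fac (suc q) j * C⁰ r (q ∸ j) x)

C⁰-at-0 : ∀ r q → C⁰ r q 0ℚ ≡ 0ℚ
C⁰-at-0 zero    q = ℚ.*-zeroˡ (pow 0ℚ q)
C⁰-at-0 (suc r) q = ∑-*-zeroʳ (suc q) (fac (suc q)) _ (λ j → C⁰-at-0 r (q ∸ j))

C⁰-1-0 : ∀ X → C⁰ 1 0 X ≡ X
C⁰-1-0 = simplify
  where
  simplify : ∀ X → 0ℚ + 1ℚ * (X * 1ℚ) ≡ X
  simplify = solve-∀ ℚ-ring

C⁰-1≡[bernoulliPoly-B]*inv : ∀ q y → C⁰ 1 q y ≡ (bernoulliPoly (suc q) y - B (suc q)) * inv (suc q)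
C⁰-1≡[bernoulliPoly-B]*inv q y = begin
  ∑ (suc q) (λ j → fac (suc q) j * pow y (suc (q ∸ j)))
    ≡⟨ ∑-cong-< (suc q) (λ j<1+q → term (ℕ.≤-pred j<1+q)) ⟩
  ∑ (suc q) (λ j → t j * inv (suc q))
    ≡⟨ ∑-*ʳ (suc q) (inv (suc q)) t ⟩
  ∑ (suc q) t * inv (suc q)
    ≡⟨ cong (_* inv (suc q)) (add-sub (∑ (suc q) t) (B (suc q))) ⟨
  (∑ (suc q) t + B (suc q) - B (suc q)) * inv (suc q)
    ≡⟨ cong (λ b → (∑ (suc q) t + b - B (suc q)) * inv (suc q)) top-term ⟨
  (bernoulliPoly (suc q) y - B (suc q)) * inv (suc q) ∎
  where
  t : ℕ → ℚ
  t j = ⟦ suc q C j ⟧ * B j * pow y (suc q ∸ j)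
  rearrange : ∀ c b u z → c * b * u * z ≡ c * b * z * u
  rearrange = solve-∀ ℚ-ring
  term : ∀ {j} → j ℕ.≤ q → fac (suc q) j * pow y (suc (q ∸ j)) ≡ t j * inv (suc q)
  term {j} j≤q = trans (cong (λ e → fac (suc q) j * pow y e) (sym (ℕ.+-∸-assoc 1 j≤q)))
                       (rearrange ⟦ suc q C j ⟧ (B j) (inv (suc q)) (pow y (suc q ∸ j)))
  add-sub : ∀ a b → a + b - b ≡ a
  add-sub = solve-∀ ℚ-ring
  top-term : ⟦ suc q C suc q ⟧ * B (suc q) * pow y (suc q ∸ suc q) ≡ B (suc q)
  top-term = begin
    ⟦ suc q C suc q ⟧ * B (suc q) * pow y (q ∸ q) ≡⟨ cong₂ (λ c e → ⟦ c ⟧ * B (suc q) * pow y e) (nCn≡1 (suc q)) (ℕ.n∸n≡0 q) ⟩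
    1ℚ * B (suc q) * 1ℚ                           ≡⟨ ℚ.*-identityʳ (1ℚ * B (suc q)) ⟩
    1ℚ * B (suc q)                                ≡⟨ ℚ.*-identityˡ (B (suc q)) ⟩
    B (suc q)                                     ∎

C⁰-1-+1 : ∀ q y → C⁰ 1 q (y + 1ℚ) ≡ C⁰ 1 q y + pow (y + 1ℚ) q
C⁰-1-+1 q y = begin
  C⁰ 1 q (y + 1ℚ)
    ≡⟨ C⁰-1≡[bernoulliPoly-B]*inv q (y + 1ℚ) ⟩
  (bernoulliPoly (suc q) (y + 1ℚ) - B (suc q)) * inv (suc q)
    ≡⟨ cong (λ P → (P - B (suc q)) * inv (suc q)) (bernoulliPoly-+1 (suc q) y) ⟩
  (bernoulliPoly (suc q) y + ⟦ suc q ⟧ * pow (y + 1ℚ) q - B (suc q)) * inv (suc q)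
    ≡⟨ split (bernoulliPoly (suc q) y) ⟦ suc q ⟧ (pow (y + 1ℚ) q) (B (suc q)) (inv (suc q)) ⟩
  (bernoulliPoly (suc q) y - B (suc q)) * inv (suc q) + pow (y + 1ℚ) q * (⟦ suc q ⟧ * inv (suc q))
    ≡⟨ cong₂ (λ c v → c + pow (y + 1ℚ) q * v) (C⁰-1≡[bernoulliPoly-B]*inv q y) (sym (⟦⟧*inv q)) ⟨
  C⁰ 1 q y + pow (y + 1ℚ) q * 1ℚ
    ≡⟨ cong (_+_ (C⁰ 1 q y)) (ℚ.*-identityʳ (pow (y + 1ℚ) q)) ⟩
  C⁰ 1 q y + pow (y + 1ℚ) q ∎
  where
  split : ∀ P X z b u → (P + X * z - b) * u ≡ (P - b) * u + z * (X * u)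
  split = solve-∀ ℚ-ring

faulhaber-step : ∀ q n → C⁰ 1 q ⟦ suc n ⟧ ≡ C⁰ 1 q ⟦ n ⟧ + pow ⟦ suc n ⟧ q
faulhaber-step q n rewrite ⟦⟧-suc n = C⁰-1-+1 q ⟦ n ⟧

faulhaber : ∀ p n → Hneg n p ≡ C⁰ 1 p ⟦ n ⟧
faulhaber p zero    = sym (C⁰-at-0 1 p)
faulhaber p (suc n) = trans (cong (_+ pow ⟦ suc n ⟧ p) (faulhaber p n)) (sym (faulhaber-step p n))

-- Cᵃ a r q is C^{(q)}_{a,…,a} with r indices a; for r = 0 it is C^{(q)} with its a lowest terms removed, divided by x^a.
Cᵃ : ℕ → ℕ → ℕ → ℚ → ℚ
Cᵃ a r q x = ∑ (suc q ∸ a) (λ j → fac (suc q) j * C⁰ r (q ∸ a ∸ j) x)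

Cᵃ-at-0 : ∀ a r q → Cᵃ a r q 0ℚ ≡ 0ℚ
Cᵃ-at-0 a r q = ∑-*-zeroʳ (suc q ∸ a) (fac (suc q)) _ (λ j → C⁰-at-0 r (q ∸ a ∸ j))

-- C⁰ (suc r) q and Cᵃ 0 r q coincide definitionally.
C⁰-step : ∀ r q n → C⁰ (suc r) q ⟦ suc n ⟧ ≡ C⁰ (suc r) q ⟦ n ⟧ + C⁰ r q ⟦ suc n ⟧ * inv (suc n)
Cᵃ-step : ∀ a r q n → Cᵃ a (suc r) q ⟦ suc n ⟧ ≡ Cᵃ a (suc r) q ⟦ n ⟧ + Cᵃ a r q ⟦ suc n ⟧ * inv (suc n)

C⁰-step zero q n = trans (faulhaber-step q n) (cong (_+_ (C⁰ 1 q ⟦ n ⟧)) (cancel ⟦ suc n ⟧ (pow ⟦ suc n ⟧ q) (inv (suc n)) (⟦⟧*inv n)))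
  where
  cancel : ∀ X z u → X * u ≡ 1ℚ → z ≡ X * z * u
  cancel X z u Xu≡1 = begin
    z             ≡⟨ ℚ.*-identityʳ z ⟨
    z * 1ℚ        ≡⟨ cong (z *_) Xu≡1 ⟨
    z * (X * u)   ≡⟨ regroup X z u ⟩
    X * z * u     ∎
    where
    regroup : ∀ X z u → z * (X * u) ≡ X * z * u
    regroup = solve-∀ ℚ-ring
C⁰-step (suc r) = Cᵃ-step 0 r

Cᵃ-step a r q n = begin
  ∑ K (λ j → fac (suc q) j * C⁰ (suc r) (q ∸ a ∸ j) X)
    ≡⟨ ∑-cong K (λ j → trans (cong (fac (suc q) j *_) (C⁰-step r (q ∸ a ∸ j) n)) (distrib (fac (suc q) j) _ _ u)) ⟩
  ∑ K (λ j → fac (suc q) j * C⁰ (suc r) (q ∸ a ∸ j) x + fac (suc q) j * C⁰ r (q ∸ a ∸ j) X * u)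
    ≡⟨ ∑-distrib-+ K _ _ ⟩
  Cᵃ a (suc r) q x + ∑ K (λ j → fac (suc q) j * C⁰ r (q ∸ a ∸ j) X * u)
    ≡⟨ cong (_+_ (Cᵃ a (suc r) q x)) (∑-*ʳ K u _) ⟩
  Cᵃ a (suc r) q x + Cᵃ a r q X * u ∎
  where
  K = suc q ∸ a
  x = ⟦ n ⟧
  X = ⟦ suc n ⟧
  u = inv (suc n)
  distrib : ∀ f c d u → f * (c + d * u) ≡ f * c + f * d * u
  distrib = solve-∀ ℚ-ring

Cᵃ-peel : ∀ a q → a ℕ.≤ q → ∀ X → Cᵃ a 0 q X ≡ X * Cᵃ (suc a) 0 q X + fac (suc q) (q ∸ a) * X
Cᵃ-peel a q a≤q X = begin
  ∑ (suc q ∸ a) f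
    ≡⟨ cong (λ K → ∑ K f) (ℕ.+-∸-assoc 1 a≤q) ⟩
  ∑ (q ∸ a) f + f (q ∸ a)
    ≡⟨ cong₂ _+_ (trans (∑-cong-< (q ∸ a) (λ j<q∸a → shift j<q∸a)) (∑-*ˡ (q ∸ a) X g)) last ⟩
  X * Cᵃ (suc a) 0 q X + fac (suc q) (q ∸ a) * X ∎
  where
  f g : ℕ → ℚ
  f j = fac (suc q) j * pow X (suc (q ∸ a ∸ j))
  g j = fac (suc q) j * pow X (suc (q ∸ suc a ∸ j))
  exponent : ∀ {j} → j ℕ.< q ∸ a → q ∸ a ∸ j ≡ suc (q ∸ suc a ∸ j)
  exponent {j} j<q∸a = begin
    q ∸ a ∸ j                ≡⟨ n∸m≡1+[n∸1+m] j<q∸a ⟩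
    suc (q ∸ a ∸ suc j)      ≡⟨ cong suc (ℕ.∸-+-assoc q a (suc j)) ⟩
    suc (q ∸ (a ℕ.+ suc j))  ≡⟨ cong (λ k → suc (q ∸ k)) (ℕ.+-suc a j) ⟩
    suc (q ∸ suc (a ℕ.+ j))  ≡⟨ cong suc (ℕ.∸-+-assoc q (suc a) j) ⟨
    suc (q ∸ suc a ∸ j)      ∎
  swap : ∀ c X z → c * (X * z) ≡ X * (c * z)
  swap = solve-∀ ℚ-ring
  shift : ∀ {j} → j ℕ.< q ∸ a → f j ≡ X * g j
  shift {j} j<q∸a = trans (cong (λ e → fac (suc q) j * pow X (suc e)) (exponent j<q∸a))
                          (swap (fac (suc q) j) X (pow X (suc (q ∸ suc a ∸ j))))
  last : f (q ∸ a) ≡ fac (suc q) (q ∸ a) * X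
  last = trans (cong (λ e → fac (suc q) (q ∸ a) * pow X (suc e)) (ℕ.n∸n≡0 (q ∸ a)))
               (cong (fac (suc q) (q ∸ a) *_) (ℚ.*-identityʳ X))

fac[1+q]q≡B : ∀ q → fac (suc q) q ≡ B q
fac[1+q]q≡B q = begin
  ⟦ suc q C q ⟧ * B q * inv (suc q)   ≡⟨ cong (λ c → ⟦ c ⟧ * B q * inv (suc q)) ([1+n]Cn≡1+n q) ⟩
  ⟦ suc q ⟧ * B q * inv (suc q)       ≡⟨ rearrange ⟦ suc q ⟧ (B q) (inv (suc q)) ⟩
  B q * (⟦ suc q ⟧ * inv (suc q))     ≡⟨ cong (B q *_) (⟦⟧*inv q) ⟩
  B q * 1ℚ                            ≡⟨ ℚ.*-identityʳ (B q) ⟩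
  B q                                 ∎
  where
  rearrange : ∀ X b u → X * b * u ≡ b * (X * u)
  rearrange = solve-∀ ℚ-ring

fac[2+m]m≡[1+m]/2*B : ∀ m → fac (suc (suc m)) m ≡ ⟦ suc m ⟧ * (+ 1 / 2) * B m
fac[2+m]m≡[1+m]/2*B m = begin
  ⟦ c ⟧ * B m * u                            ≡⟨ halve ⟦ c ⟧ (B m) u ⟩
  ⟦ c ⟧ * ⟦ 2 ⟧ * (+ 1 / 2) * B m * u        ≡⟨ cong (λ z → z * (+ 1 / 2) * B m * u) c*2≡X*[1+m] ⟩
  X * ⟦ suc m ⟧ * (+ 1 / 2) * B m * u        ≡⟨ regroup X ⟦ suc m ⟧ (B m) u ⟩
  ⟦ suc m ⟧ * (+ 1 / 2) * B m * (X * u)      ≡⟨ cong (⟦ suc m ⟧ * (+ 1 / 2) * B m *_) (⟦⟧*inv (suc m)) ⟩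
  ⟦ suc m ⟧ * (+ 1 / 2) * B m * 1ℚ           ≡⟨ ℚ.*-identityʳ _ ⟩
  ⟦ suc m ⟧ * (+ 1 / 2) * B m                ∎
  where
  c = suc (suc m) C m
  X = ⟦ suc (suc m) ⟧
  u = inv (suc (suc m))
  halve : ∀ c b u → c * b * u ≡ c * ⟦ 2 ⟧ * (+ 1 / 2) * b * u
  halve = solve-∀ ℚ-ring
  regroup : ∀ X y b u → X * y * (+ 1 / 2) * b * u ≡ y * (+ 1 / 2) * b * (X * u)
  regroup = solve-∀ ℚ-ring
  c*2≡X*[1+m] : ⟦ c ⟧ * ⟦ 2 ⟧ ≡ X * ⟦ suc m ⟧
  c*2≡X*[1+m] = begin
    ⟦ c ⟧ * ⟦ 2 ⟧                      ≡⟨ ⟦⟧-* c 2 ⟨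
    ⟦ c ℕ.* 2 ⟧                        ≡⟨ cong (λ k → ⟦ c ℕ.* k ⟧) (ℕ.m+n∸n≡m 2 m) ⟨
    ⟦ c ℕ.* (suc (suc m) ∸ m) ⟧        ≡⟨ cong ⟦_⟧ ([1+m]Ci*[1+m∸i]≡[1+m]*mCi (ℕ.n≤1+n m)) ⟩
    ⟦ suc (suc m) ℕ.* (suc m C m) ⟧    ≡⟨ cong (λ k → ⟦ suc (suc m) ℕ.* k ⟧) ([1+n]Cn≡1+n m) ⟩
    ⟦ suc (suc m) ℕ.* suc m ⟧          ≡⟨ ⟦⟧-* (suc (suc m)) (suc m) ⟩
    X * ⟦ suc m ⟧                      ∎

Cᵃ-1-0-tail : ∀ q X u → X * u ≡ 1ℚ → Cᵃ 1 0 q X * u ≡ C⁰ 1 q X * u * u - B q * u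
Cᵃ-1-0-tail q X u Xu≡1 = sym (begin
  C⁰ 1 q X * u * u - B q * u
    ≡⟨ cong (λ C → C * u * u - B q * u) (trans (Cᵃ-peel 0 q z≤n X) (cong (λ b → X * T + b * X) (fac[1+q]q≡B q))) ⟩
  (X * T + B q * X) * u * u - B q * u
    ≡⟨ expand T (B q) X u ⟩
  T * u * (X * u) + B q * u * (X * u) - B q * u
    ≡⟨ cong (λ w → T * u * w + B q * u * w - B q * u) Xu≡1 ⟩
  T * u * 1ℚ + B q * u * 1ℚ - B q * u
    ≡⟨ simplify (T * u) (B q * u) ⟩
  T * u ∎)
  where
  T = Cᵃ 1 0 q X
  expand : ∀ T b X u → (X * T + b * X) * u * u - b * u ≡ T * u * (X * u) + b * u * (X * u) - b * u
  expand = solve-∀ ℚ-ring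
  simplify : ∀ t c → t * 1ℚ + c * 1ℚ - c ≡ t
  simplify = solve-∀ ℚ-ring

Cᵃ-2-0-tail : ∀ q X u → X * u ≡ 1ℚ →
  Cᵃ 2 0 q X * u ≡ C⁰ 1 q X * u * u * u - B q * u * u - ⟦ q ⟧ * (+ 1 / 2) * B (q ∸ 1) * u
Cᵃ-2-0-tail zero X u Xu≡1 = sym (begin
  (0ℚ + 1ℚ * (X * 1ℚ)) * u * u * u - 1ℚ * u * u - 0ℚ * (+ 1 / 2) * 1ℚ * u ≡⟨ expand X u ⟩
  (X * u) * u * u - u * u                                                  ≡⟨ cong (λ w → w * u * u - u * u) Xu≡1 ⟩
  1ℚ * u * u - u * u                                                       ≡⟨ simplify u ⟩
  0ℚ * u                                                                   ∎)
  where
  expand : ∀ X u → (0ℚ + 1ℚ * (X * 1ℚ)) * u * u * u - 1ℚ * u * u - 0ℚ * (+ 1 / 2) * 1ℚ * u ≡ (X * u) * u * u - u * u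
  expand = solve-∀ ℚ-ring
  simplify : ∀ u → 1ℚ * u * u - u * u ≡ 0ℚ * u
  simplify = solve-∀ ℚ-ring
Cᵃ-2-0-tail (suc m) X u Xu≡1 = begin
  W * u
    ≡⟨ simplify W F u ⟨
  (W * 1ℚ + F * 1ℚ - F) * u
    ≡⟨ cong (λ w → (W * w + F * w - F) * u) Xu≡1 ⟨
  (W * (X * u) + F * (X * u) - F) * u
    ≡⟨ expand W F X u ⟩
  ((X * W + F * X) * u - F) * u
    ≡⟨ cong (λ T → (T * u - F) * u) (Cᵃ-peel 1 (suc m) (s≤s z≤n) X) ⟨
  (Cᵃ 1 0 (suc m) X * u - F) * u
    ≡⟨ cong (λ t → (t - F) * u) (Cᵃ-1-0-tail (suc m) X u Xu≡1) ⟩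
  (C⁰ 1 (suc m) X * u * u - B (suc m) * u - F) * u
    ≡⟨ distrib (C⁰ 1 (suc m) X) (B (suc m)) F u ⟩
  C⁰ 1 (suc m) X * u * u * u - B (suc m) * u * u - F * u
    ≡⟨ cong (λ f → C⁰ 1 (suc m) X * u * u * u - B (suc m) * u * u - f * u) (fac[2+m]m≡[1+m]/2*B m) ⟩
  C⁰ 1 (suc m) X * u * u * u - B (suc m) * u * u - ⟦ suc m ⟧ * (+ 1 / 2) * B m * u ∎
  where
  W = Cᵃ 2 0 (suc m) X
  F = fac (suc (suc m)) m
  simplify : ∀ W F u → (W * 1ℚ + F * 1ℚ - F) * u ≡ W * u
  simplify = solve-∀ ℚ-ring
  expand : ∀ W F X u → (W * (X * u) + F * (X * u) - F) * u ≡ ((X * W + F * X) * u - F) * u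
  expand = solve-∀ ℚ-ring
  distrib : ∀ C b F u → (C * u * u - b * u - F) * u ≡ C * u * u * u - b * u * u - F * u
  distrib = solve-∀ ℚ-ring

C₀₁ : ℕ → ℚ → ℚ
C₀₁ p x = ∑ p (λ j → fac (suc p) j * Cᵃ 1 1 (p ∸ j) x)

C₀₁-at-0 : ∀ p → C₀₁ p 0ℚ ≡ 0ℚ
C₀₁-at-0 p = ∑-*-zeroʳ p (fac (suc p)) _ (λ j → Cᵃ-at-0 1 1 (p ∸ j))

C₀₁-increment : ∀ p X u → X * u ≡ 1ℚ →
  ∑ p (λ j → fac (suc p) j * (Cᵃ 1 0 (p ∸ j) X * u)) ≡ C⁰ 2 p X * u * u - DB p * u
C₀₁-increment p X u Xu≡1 = begin
  ∑ p (λ j → f j * (Cᵃ 1 0 (p ∸ j) X * u))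
    ≡⟨ ∑-cong p (λ j → trans (cong (f j *_) (Cᵃ-1-0-tail (p ∸ j) X u Xu≡1)) (distrib (f j) _ _ u)) ⟩
  ∑ p (λ j → f j * C⁰ 1 (p ∸ j) X * u * u - f j * B (p ∸ j) * u)
    ≡⟨ ∑-distrib-minus p _ _ ⟩
  ∑ p (λ j → f j * C⁰ 1 (p ∸ j) X * u * u) - ∑ p (λ j → f j * B (p ∸ j) * u)
    ≡⟨ cong₂ _-_ (trans (∑-*ʳ p u _) (cong (_* u) (∑-*ʳ p u _))) (∑-*ʳ p u _) ⟩
  Σa * u * u - Σb * u
    ≡⟨ complete Σa Σb (B p) ⟩
  (Σa + B p * X) * u * u - (Σb + B p * 1ℚ) * u
    ≡⟨ cong₂ (λ s t → (Σa + s) * u * u - (Σb + t) * u) top-C⁰ top-B ⟨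
  C⁰ 2 p X * u * u - DB p * u ∎
  where
  f = fac (suc p)
  Σa = ∑ p (λ j → f j * C⁰ 1 (p ∸ j) X)
  Σb = ∑ p (λ j → f j * B (p ∸ j))
  distrib : ∀ f C b u → f * (C * u * u - b * u) ≡ f * C * u * u - f * b * u
  distrib = solve-∀ ℚ-ring
  expand : ∀ a b c X u → (a + c * X) * u * u - (b + c * 1ℚ) * u ≡ a * u * u - b * u + c * (X * u) * u - c * u
  expand = solve-∀ ℚ-ring
  simplify : ∀ t c u → t + c * 1ℚ * u - c * u ≡ t
  simplify = solve-∀ ℚ-ring
  complete : ∀ a b c → a * u * u - b * u ≡ (a + c * X) * u * u - (b + c * 1ℚ) * u
  complete a b c = sym (begin
    (a + c * X) * u * u - (b + c * 1ℚ) * u      ≡⟨ expand a b c X u ⟩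
    a * u * u - b * u + c * (X * u) * u - c * u ≡⟨ cong (λ w → a * u * u - b * u + c * w * u - c * u) Xu≡1 ⟩
    a * u * u - b * u + c * 1ℚ * u - c * u      ≡⟨ simplify (a * u * u - b * u) c u ⟩
    a * u * u - b * u                           ∎)
  top-C⁰ : f p * C⁰ 1 (p ∸ p) X ≡ B p * X
  top-C⁰ = cong₂ _*_ (fac[1+q]q≡B p) (trans (cong (λ k → C⁰ 1 k X) (ℕ.n∸n≡0 p)) (C⁰-1-0 X))
  top-B : f p * B (p ∸ p) ≡ B p * 1ℚ
  top-B = cong₂ (λ c k → c * B k) (fac[1+q]q≡B p) (ℕ.n∸n≡0 p)

C₀₁-step : ∀ p n → C₀₁ p ⟦ suc n ⟧ ≡ C₀₁ p ⟦ n ⟧ + (C⁰ 2 p ⟦ suc n ⟧ * inv (suc n) * inv (suc n) - DB p * inv (suc n))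
C₀₁-step p n = begin
  C₀₁ p X
    ≡⟨ ∑-cong p (λ j → trans (cong (f j *_) (Cᵃ-step 1 0 (p ∸ j) n)) (ℚ.*-distribˡ-+ (f j) _ _)) ⟩
  ∑ p (λ j → f j * Cᵃ 1 1 (p ∸ j) x + f j * (Cᵃ 1 0 (p ∸ j) X * u))
    ≡⟨ ∑-distrib-+ p _ _ ⟩
  C₀₁ p x + ∑ p (λ j → f j * (Cᵃ 1 0 (p ∸ j) X * u))
    ≡⟨ cong (_+_ (C₀₁ p x)) (C₀₁-increment p X u (⟦⟧*inv n)) ⟩
  C₀₁ p x + (C⁰ 2 p X * u * u - DB p * u) ∎
  where
  x = ⟦ n ⟧
  X = ⟦ suc n ⟧
  u = inv (suc n)
  f = fac (suc p)

-- The nested sums of Cp with the last index aᵣ and the running sum J = j₁ + ⋯ + j_{i-1} exposed.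
-- Only for a concrete list as does Cp p as x unfold to Cp-sum p (lastℕ 0 as) x 0 (0 ∷ as).
Cp-sum : ℕ → ℕ → ℚ → ℕ → List ℕ → ℚ
Cp-sum p aᵣ x J []         = pow x (suc p ∸ aᵣ ∸ J)
Cp-sum p aᵣ x J (a ∷ rest) =
  ∑ (suc (suc p)) (λ j →
    if does (aᵣ ℕ.+ J ℕ.+ j ≤? p)
    then fac (suc p ∸ (a ℕ.+ J)) j * Cp-sum p aᵣ x (J ℕ.+ j) rest
    else 0ℚ)

Cp-sum-cons : ∀ p aᵣ x J a rest (g : ℕ → ℚ) →
  (∀ {j} → aᵣ ℕ.+ J ℕ.+ j ℕ.≤ p → Cp-sum p aᵣ x (J ℕ.+ j) rest ≡ g j) →
  Cp-sum p aᵣ x J (a ∷ rest) ≡ ∑ (suc p ∸ aᵣ ∸ J) (λ j → fac (suc p ∸ (a ℕ.+ J)) j * g j)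
Cp-sum-cons p aᵣ x J a rest g eq = begin
  Cp-sum p aᵣ x J (a ∷ rest)
    ≡⟨ ∑-truncate (suc (suc p)) _ K≤2+p outside ⟩
  ∑ K _
    ≡⟨ ∑-cong-< K inside ⟩
  ∑ K (λ j → fac (suc p ∸ (a ℕ.+ J)) j * g j) ∎
  where
  K = suc p ∸ aᵣ ∸ J
  K≡1+p∸[aᵣ+J] : K ≡ suc p ∸ (aᵣ ℕ.+ J)
  K≡1+p∸[aᵣ+J] = ℕ.∸-+-assoc (suc p) aᵣ J
  K≤2+p : K ℕ.≤ suc (suc p)
  K≤2+p = ℕ.≤-trans (ℕ.≤-trans (ℕ.m∸n≤m (suc p ∸ aᵣ) J) (ℕ.m∸n≤m (suc p) aᵣ)) (ℕ.n≤1+n (suc p))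
  inside : ∀ {j} → j ℕ.< K →
    (if does (aᵣ ℕ.+ J ℕ.+ j ≤? p) then fac (suc p ∸ (a ℕ.+ J)) j * Cp-sum p aᵣ x (J ℕ.+ j) rest else 0ℚ)
    ≡ fac (suc p ∸ (a ℕ.+ J)) j * g j
  inside {j} j<K = if-does-elim (aᵣ ℕ.+ J ℕ.+ j ≤? p) (_≡ fac (suc p ∸ (a ℕ.+ J)) j * g j)
    (λ in-range → cong (fac (suc p ∸ (a ℕ.+ J)) j *_) (eq in-range))
    (λ ¬in-range → ⊥-elim (¬in-range (j<1+p∸m⇒m+j≤p (aᵣ ℕ.+ J) (subst (j ℕ.<_) K≡1+p∸[aᵣ+J] j<K))))
  outside : ∀ {j} → K ℕ.≤ j → j ℕ.< suc (suc p) →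
    (if does (aᵣ ℕ.+ J ℕ.+ j ≤? p) then fac (suc p ∸ (a ℕ.+ J)) j * Cp-sum p aᵣ x (J ℕ.+ j) rest else 0ℚ)
    ≡ 0ℚ
  outside {j} K≤j _ = if-does-elim (aᵣ ℕ.+ J ℕ.+ j ≤? p) (_≡ 0ℚ)
    (λ in-range → ⊥-elim (ℕ.<⇒≱ (m+j≤p⇒j<1+p∸m (aᵣ ℕ.+ J) in-range) (subst (ℕ._≤ j) K≡1+p∸[aᵣ+J] K≤j)))
    (λ _ → refl)

Cp-sum-replicate : ∀ p aᵣ x r J → aᵣ ℕ.+ J ℕ.≤ p → Cp-sum p aᵣ x J (replicate r aᵣ) ≡ C⁰ r (p ∸ aᵣ ∸ J) x
Cp-sum-replicate p aᵣ x zero    J aᵣ+J≤p = cong (pow x) ([1+p]∸m∸n≡1+[p∸m∸n] aᵣ J aᵣ+J≤p)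
Cp-sum-replicate p aᵣ x (suc r) J aᵣ+J≤p = begin
  Cp-sum p aᵣ x J (replicate (suc r) aᵣ)
    ≡⟨ Cp-sum-cons p aᵣ x J aᵣ (replicate r aᵣ) (λ j → C⁰ r (q ∸ j) x) recurse ⟩
  ∑ (suc p ∸ aᵣ ∸ J) (λ j → fac (suc p ∸ (aᵣ ℕ.+ J)) j * C⁰ r (q ∸ j) x)
    ≡⟨ cong₂ (λ K N → ∑ K (λ j → fac N j * C⁰ r (q ∸ j) x))
             ([1+p]∸m∸n≡1+[p∸m∸n] aᵣ J aᵣ+J≤p) ([1+p]∸[m+n]≡1+[p∸m∸n] aᵣ J aᵣ+J≤p) ⟩
  C⁰ (suc r) q x ∎
  where
  q = p ∸ aᵣ ∸ J
  recurse : ∀ {j} → aᵣ ℕ.+ J ℕ.+ j ℕ.≤ p → Cp-sum p aᵣ x (J ℕ.+ j) (replicate r aᵣ) ≡ C⁰ r (q ∸ j) x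
  recurse {j} in-range = trans (Cp-sum-replicate p aᵣ x r (J ℕ.+ j) (subst (ℕ._≤ p) (ℕ.+-assoc aᵣ J j) in-range))
                               (cong (λ k → C⁰ r k x) (sym (ℕ.∸-+-assoc (p ∸ aᵣ) J j)))

Cp-sum-Cᵃ : ∀ p a r x → Cp-sum p a x 0 (0 ∷ replicate (suc r) a) ≡ Cᵃ a (suc r) p x
Cp-sum-Cᵃ p a r x = Cp-sum-cons p a x 0 0 (replicate (suc r) a) (λ j → C⁰ (suc r) (p ∸ a ∸ j) x)
  (λ {j} in-range → Cp-sum-replicate p a x (suc r) j (subst (λ k → k ℕ.+ j ℕ.≤ p) (ℕ.+-identityʳ a) in-range))

Cp-sum-C₀₁ : ∀ p x → Cp-sum p 1 x 0 (0 ∷ 0 ∷ 1 ∷ []) ≡ C₀₁ p x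
Cp-sum-C₀₁ p x = Cp-sum-cons p 1 x 0 0 (0 ∷ 1 ∷ []) (λ j → Cᵃ 1 1 (p ∸ j) x) inner
  where
  exponent : ∀ j k → p ∸ 1 ∸ (j ℕ.+ k) ≡ p ∸ j ∸ 1 ∸ k
  exponent j k = begin
    p ∸ 1 ∸ (j ℕ.+ k)    ≡⟨ ℕ.∸-+-assoc p 1 (j ℕ.+ k) ⟩
    p ∸ suc (j ℕ.+ k)    ≡⟨ cong (p ∸_) (ℕ.+-suc j k) ⟨
    p ∸ (j ℕ.+ suc k)    ≡⟨ ℕ.∸-+-assoc p j (suc k) ⟨
    p ∸ j ∸ suc k        ≡⟨ ℕ.∸-+-assoc (p ∸ j) 1 k ⟨
    p ∸ j ∸ 1 ∸ k        ∎
  inner : ∀ {j} → 1 ℕ.+ j ℕ.≤ p → Cp-sum p 1 x j (0 ∷ 1 ∷ []) ≡ Cᵃ 1 1 (p ∸ j) x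
  inner {j} j<p = begin
    Cp-sum p 1 x j (0 ∷ 1 ∷ [])
      ≡⟨ Cp-sum-cons p 1 x j 0 (1 ∷ []) (λ k → C⁰ 1 (p ∸ j ∸ 1 ∸ k) x)
           (λ {k} in-range → trans (Cp-sum-replicate p 1 x 1 (j ℕ.+ k) in-range) (cong (λ e → C⁰ 1 e x) (exponent j k))) ⟩
    ∑ (p ∸ j) (λ k → fac (suc p ∸ j) k * C⁰ 1 (p ∸ j ∸ 1 ∸ k) x)
      ≡⟨ cong (λ N → ∑ (p ∸ j) (λ k → fac N k * C⁰ 1 (p ∸ j ∸ 1 ∸ k) x)) (ℕ.+-∸-assoc 1 (ℕ.<⇒≤ j<p)) ⟩
    Cᵃ 1 1 (p ∸ j) x ∎

-- Telescoping

-- Stated over an arbitrary signature so that it can be read both in ℚ and in the ring solver's expression syntax.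
rhs-shape : {A : Set} (plus minus times : A → A → A) (κ : ℚ → A) (b b′ p̂ d h S k₂ c₀ c₀₀ c₀₀₀ c₁ c₀₁ c₁₁ c₂ : A) → A
rhs-shape plus minus times κ b b′ p̂ d h S k₂ c₀ c₀₀ c₀₀₀ c₁ c₀₁ c₁₁ c₂ =
  S ⊗ (h ⊗ (h ⊗ (h ⊗ κ 1ℚ)))
  ⊖ κ ⟦ 3 ⟧ ⊗ (c₀ ⊕ b ⊗ κ (+ 1 / 2)) ⊗ (h ⊗ (h ⊗ κ 1ℚ))
  ⊕ b ⊗ κ (+ 1 / 2) ⊗ k₂
  ⊕ (κ ⟦ 6 ⟧ ⊗ c₀₀ ⊕ κ ⟦ 3 ⟧ ⊗ d ⊖ κ ⟦ 3 ⟧ ⊗ c₁ ⊖ p̂ ⊗ κ (+ 1 / 2) ⊗ b′) ⊗ h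
  ⊖ κ ⟦ 6 ⟧ ⊗ c₀₀₀ ⊕ κ ⟦ 3 ⟧ ⊗ c₀₁ ⊕ κ ⟦ 3 ⟧ ⊗ c₁₁ ⊖ c₂
  where
  infixl 6 _⊕_ _⊖_
  infixl 7 _⊗_
  _⊕_ = plus
  _⊖_ = minus
  _⊗_ = times

rhs-form : (b b′ p̂ d h S k₂ c₀ c₀₀ c₀₀₀ c₁ c₀₁ c₁₁ c₂ : ℚ) → ℚ
rhs-form = rhs-shape _+_ _-_ _*_ id

rhs-form-cong : ∀ b b′ p̂ d h k₂ {S S′ c₀ c₀′ c₀₀ c₀₀′ c₀₀₀ c₀₀₀′ c₁ c₁′ c₀₁ c₀₁′ c₁₁ c₁₁′ c₂ c₂′} →
  S ≡ S′ → c₀ ≡ c₀′ → c₀₀ ≡ c₀₀′ → c₀₀₀ ≡ c₀₀₀′ → c₁ ≡ c₁′ → c₀₁ ≡ c₀₁′ → c₁₁ ≡ c₁₁′ → c₂ ≡ c₂′ →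
  rhs-form b b′ p̂ d h S k₂ c₀ c₀₀ c₀₀₀ c₁ c₀₁ c₁₁ c₂ ≡ rhs-form b b′ p̂ d h S′ k₂ c₀′ c₀₀′ c₀₀₀′ c₁′ c₀₁′ c₁₁′ c₂′
rhs-form-cong b b′ p̂ d h k₂ refl refl refl refl refl refl refl refl = refl

rhs-form-at-0 : ∀ b b′ p̂ d → rhs-form b b′ p̂ d 0ℚ 0ℚ 0ℚ 0ℚ 0ℚ 0ℚ 0ℚ 0ℚ 0ℚ 0ℚ ≡ 0ℚ
rhs-form-at-0 = solve 4 (λ b b′ p̂ d →
  rhs-shape _:+_ _:-_ _:*_ con b b′ p̂ d (con 0ℚ) (con 0ℚ) (con 0ℚ) (con 0ℚ) (con 0ℚ) (con 0ℚ) (con 0ℚ) (con 0ℚ) (con 0ℚ) (con 0ℚ)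
    := con 0ℚ) refl

rhs-form-step : ∀ b b′ p̂ d h S P u k₂ c₀ c₀₀ c₀₀₀ c₁ c₀₁ c₁₁ c₂ →
  let S′  = S + P
      c₀′  = c₀ + S′ * u
      c₀₀′ = c₀₀ + c₀′ * u
      c₁′  = c₁ + (S′ * u * u - b * u)
  in rhs-form b b′ p̂ d (h + u * 1ℚ) S′ (k₂ + u * (u * 1ℚ)) c₀′ c₀₀′ (c₀₀₀ + c₀₀′ * u) c₁′
       (c₀₁ + (c₀′ * u * u - d * u)) (c₁₁ + c₁′ * u) (c₂ + (S′ * u * u * u - b * u * u - p̂ * (+ 1 / 2) * b′ * u))
     ≡ rhs-form b b′ p̂ d h S k₂ c₀ c₀₀ c₀₀₀ c₁ c₀₁ c₁₁ c₂ + P * pow h 3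
rhs-form-step = solve 16 (λ b b′ p̂ d h S P u k₂ c₀ c₀₀ c₀₀₀ c₁ c₀₁ c₁₁ c₂ →
  let S′   = S :+ P
      c₀′  = c₀ :+ S′ :* u
      c₀₀′ = c₀₀ :+ c₀′ :* u
      c₁′  = c₁ :+ (S′ :* u :* u :- b :* u)
      F    = rhs-shape _:+_ _:-_ _:*_ con b b′ p̂ d
  in F (h :+ u :* con 1ℚ) S′ (k₂ :+ u :* (u :* con 1ℚ)) c₀′ c₀₀′ (c₀₀₀ :+ c₀₀′ :* u) c₁′
       (c₀₁ :+ (c₀′ :* u :* u :- d :* u)) (c₁₁ :+ c₁′ :* u) (c₂ :+ (S′ :* u :* u :* u :- b :* u :* u :- p̂ :* con (+ 1 / 2) :* b′ :* u))
     := F h S k₂ c₀ c₀₀ c₀₀₀ c₁ c₀₁ c₁₁ c₂ :+ P :* (h :* (h :* (h :* con 1ℚ))))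
  refl

rhs : ℕ → ℕ → ℚ
rhs p n = rhs-form (B p) (B (p ∸ 1)) ⟦ p ⟧ (DB p) (H n) (Hneg n p) (Hk n 2)
  (Cp p (0 ∷ []) ⟦ n ⟧) (Cp p (0 ∷ 0 ∷ []) ⟦ n ⟧) (Cp p (0 ∷ 0 ∷ 0 ∷ []) ⟦ n ⟧)
  (Cp p (1 ∷ []) ⟦ n ⟧) (Cp p (0 ∷ 1 ∷ []) ⟦ n ⟧) (Cp p (1 ∷ 1 ∷ []) ⟦ n ⟧) (Cp p (2 ∷ []) ⟦ n ⟧)

rhs-C : ℕ → ℕ → ℚ
rhs-C p n = rhs-form (B p) (B (p ∸ 1)) ⟦ p ⟧ (DB p) (H n) (C⁰ 1 p ⟦ n ⟧) (Hk n 2)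
  (C⁰ 2 p ⟦ n ⟧) (C⁰ 3 p ⟦ n ⟧) (C⁰ 4 p ⟦ n ⟧) (Cᵃ 1 1 p ⟦ n ⟧) (C₀₁ p ⟦ n ⟧) (Cᵃ 1 2 p ⟦ n ⟧) (Cᵃ 2 1 p ⟦ n ⟧)

rhs≡rhs-C : ∀ p n → rhs p n ≡ rhs-C p n
rhs≡rhs-C p n = rhs-form-cong (B p) (B (p ∸ 1)) ⟦ p ⟧ (DB p) (H n) (Hk n 2) (faulhaber p n)
  (Cp-sum-Cᵃ p 0 0 x) (Cp-sum-Cᵃ p 0 1 x) (Cp-sum-Cᵃ p 0 2 x)
  (Cp-sum-Cᵃ p 1 0 x) (Cp-sum-C₀₁ p x) (Cp-sum-Cᵃ p 1 1 x) (Cp-sum-Cᵃ p 2 0 x)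
  where x = ⟦ n ⟧

rhs-C-step : ∀ p n → rhs-C p (suc n) ≡ rhs-C p n + pow ⟦ suc n ⟧ p * pow (H n) 3
rhs-C-step p n = begin
  rhs-C p (suc n)
    ≡⟨ rhs-form-cong (B p) (B (p ∸ 1)) ⟦ p ⟧ (DB p) (H (suc n)) (Hk (suc n) 2) S-step c₀-step c₀₀-step c₀₀₀-step
                     c₁-step c₀₁-step c₁₁-step c₂-step ⟩
  rhs-form (B p) (B (p ∸ 1)) ⟦ p ⟧ (DB p) (H n + u * 1ℚ) (S + P) (Hk n 2 + u * (u * 1ℚ))
    c₀′ c₀₀′ (C⁰ 4 p x + c₀₀′ * u) c₁′
    (C₀₁ p x + (c₀′ * u * u - DB p * u)) (Cᵃ 1 2 p x + c₁′ * u)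
    (Cᵃ 2 1 p x + ((S + P) * u * u * u - B p * u * u - ⟦ p ⟧ * (+ 1 / 2) * B (p ∸ 1) * u))
    ≡⟨ rhs-form-step (B p) (B (p ∸ 1)) ⟦ p ⟧ (DB p) (H n) S P u (Hk n 2) (C⁰ 2 p x) (C⁰ 3 p x) (C⁰ 4 p x)
                     (Cᵃ 1 1 p x) (C₀₁ p x) (Cᵃ 1 2 p x) (Cᵃ 2 1 p x) ⟩
  rhs-C p n + P * pow (H n) 3 ∎
  where
  x = ⟦ n ⟧
  X = ⟦ suc n ⟧
  u = inv (suc n)
  S = C⁰ 1 p x
  P = pow X p
  c₀′ = C⁰ 2 p x + (S + P) * u
  c₀₀′ = C⁰ 3 p x + c₀′ * u
  c₁′ = Cᵃ 1 1 p x + ((S + P) * u * u - B p * u)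
  S-step : C⁰ 1 p X ≡ S + P
  S-step = faulhaber-step p n
  c₀-step : C⁰ 2 p X ≡ c₀′
  c₀-step = trans (C⁰-step 1 p n) (cong (λ c → C⁰ 2 p x + c * u) S-step)
  c₀₀-step : C⁰ 3 p X ≡ c₀₀′
  c₀₀-step = trans (C⁰-step 2 p n) (cong (λ c → C⁰ 3 p x + c * u) c₀-step)
  c₀₀₀-step : C⁰ 4 p X ≡ C⁰ 4 p x + c₀₀′ * u
  c₀₀₀-step = trans (C⁰-step 3 p n) (cong (λ c → C⁰ 4 p x + c * u) c₀₀-step)
  c₁-step : Cᵃ 1 1 p X ≡ c₁′
  c₁-step = trans (Cᵃ-step 1 0 p n)
    (cong (_+_ (Cᵃ 1 1 p x)) (trans (Cᵃ-1-0-tail p X u (⟦⟧*inv n)) (cong (λ c → c * u * u - B p * u) S-step)))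
  c₀₁-step : C₀₁ p X ≡ C₀₁ p x + (c₀′ * u * u - DB p * u)
  c₀₁-step = trans (C₀₁-step p n) (cong (λ c → C₀₁ p x + (c * u * u - DB p * u)) c₀-step)
  c₁₁-step : Cᵃ 1 2 p X ≡ Cᵃ 1 2 p x + c₁′ * u
  c₁₁-step = trans (Cᵃ-step 1 1 p n) (cong (λ c → Cᵃ 1 2 p x + c * u) c₁-step)
  c₂-step : Cᵃ 2 1 p X ≡ Cᵃ 2 1 p x + ((S + P) * u * u * u - B p * u * u - ⟦ p ⟧ * (+ 1 / 2) * B (p ∸ 1) * u)
  c₂-step = trans (Cᵃ-step 2 0 p n)
    (cong (_+_ (Cᵃ 2 1 p x)) (trans (Cᵃ-2-0-tail p X u (⟦⟧*inv n))
      (cong (λ c → c * u * u * u - B p * u * u - ⟦ p ⟧ * (+ 1 / 2) * B (p ∸ 1) * u) S-step)))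

sum≡rhs-C : ∀ p n → ∑₁ n (λ m → pow ⟦ m ⟧ p * pow (H (m ∸ 1)) 3) ≡ rhs-C p n
sum≡rhs-C p zero = sym (trans
  (rhs-form-cong (B p) (B (p ∸ 1)) ⟦ p ⟧ (DB p) 0ℚ 0ℚ (C⁰-at-0 1 p) (C⁰-at-0 2 p) (C⁰-at-0 3 p) (C⁰-at-0 4 p)
                 (Cᵃ-at-0 1 1 p) (C₀₁-at-0 p) (Cᵃ-at-0 1 2 p) (Cᵃ-at-0 2 1 p))
  (rhs-form-at-0 (B p) (B (p ∸ 1)) ⟦ p ⟧ (DB p)))
sum≡rhs-C p (suc n) =
  trans (cong (_+ pow ⟦ suc n ⟧ p * pow (H n) 3) (sum≡rhs-C p n)) (sym (rhs-C-step p n))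

theorem2p9 : (p n : ℕ) → 1 ℕ.≤ n →
    ∑₁ n (λ m → pow ⟦ m ⟧ p * pow (H (m ∸ 1)) 3)
    ≡ Hneg n p * pow (H n) 3
      - ⟦ 3 ⟧ * (Cp p (0 ∷ []) ⟦ n ⟧ + B p * (+ 1 / 2)) * pow (H n) 2
      + B p * (+ 1 / 2) * Hk n 2
      + (⟦ 6 ⟧ * Cp p (0 ∷ 0 ∷ []) ⟦ n ⟧ + ⟦ 3 ⟧ * DB p - ⟦ 3 ⟧ * Cp p (1 ∷ []) ⟦ n ⟧
          - ⟦ p ⟧ * (+ 1 / 2) * B (p ∸ 1)) * H n
      - ⟦ 6 ⟧ * Cp p (0 ∷ 0 ∷ 0 ∷ []) ⟦ n ⟧ + ⟦ 3 ⟧ * Cp p (0 ∷ 1 ∷ []) ⟦ n ⟧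
      + ⟦ 3 ⟧ * Cp p (1 ∷ 1 ∷ []) ⟦ n ⟧ - Cp p (2 ∷ []) ⟦ n ⟧
theorem2p9 p n _ = trans (sum≡rhs-C p n) (sym (rhs≡rhs-C p n))
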